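{- Let $n,m,m'\in\mathbb N$ with $m,m'$ coprime, and let $\{R_j\}_{j\in J}$ be a system of representatives of the right cosets in $\Gamma_0(mm'n)\backslash\Gamma_0(mn)$. Then the matrices $\overline{R_j}=B_mR_jB_m^{ -1}$, $j\in J$, form a system of representatives of the right cosets in $\Gamma_0(m'n)\backslash\Gamma_0(n)$.
   Context: $B_m=\begin{pmatrix}m&0\\0&1\end{pmatrix}$; $\Gamma_0(N)=\{\begin{pmatrix}a&b\\c&d\end{pmatrix}\in SL(2,\mathbb Z):N\mid c\}$. For $g\in\Gamma_0(mn)$, $B_mgB_m^{ -1}$ lies in $\Gamma_0(n,m)=\{\begin{pmatrix}a&b\\c&d\end{pmatrix}\in SL(2,\mathbb Z):n\mid c,\ m\mid b\}\subset\Gamma_0(n)$. -}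

module Defs where

open import Data.Nat as ℕ using (ℕ; NonZero)
open import Data.Integer using (ℤ; +_; _+_; _*_; -_; _-_; 1ℤ)
open import Data.Integer.DivMod using (_/ℕ_)
open import Data.Integer.Divisibility using (_∣_)
open import Data.Product using (_×_; ∃)
open import Relation.Binary.PropositionalEquality using (_≡_)

record M2 : Set where
  constructor mat
  field
    a b c d : ℤ
open M2 public

infixl 7 _·_
_·_ : M2 → M2 → M2
mat a₁ b₁ c₁ d₁ · mat a₂ b₂ c₂ d₂ =
  mat (a₁ * a₂ + b₁ * c₂) (a₁ * b₂ + b₁ * d₂)
      (c₁ * a₂ + d₁ * c₂) (c₁ * b₂ + d₁ * d₂)

det : M2 → ℤ
det g = a g * d g - b g * c g

-- adjugate; equals the inverse for g ∈ SL(2,ℤ)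
adj : M2 → M2
adj g = mat (d g) (- b g) (- c g) (a g)

Γ₀ : ℕ → M2 → Set
Γ₀ N g = (det g ≡ 1ℤ) × ((+ N) ∣ c g)

-- B_m = (m 0 ; 0 1).  For g = (a b ; c d) with m ∣ c (e.g. g ∈ Γ₀(mn)),
-- B_m g B_m⁻¹ = (a  m·b ; c/m  d), which is what conjB computes
-- (the division is exact in that case).
B : ℕ → M2
B m = mat (+ m) (+ 0) (+ 0) (+ 1)

conjB : (m : ℕ) → .{{NonZero m}} → M2 → M2
conjB m g = mat (a g) (+ m * b g) (c g /ℕ m) (d g)

-- {R_j}_{j∈J} is a system of representatives of the right cosets H\G:
-- every R_j lies in G, every g ∈ G lies in H·R_j for some j,
-- and distinct indices give distinct cosets (H R_j = H R_j' ⇒ j = j').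
-- (H g = H g'  iff  g · g'⁻¹ ∈ H; for g' ∈ SL₂(ℤ), g'⁻¹ = adj g'.)
IsRightCosetReps : (H G : M2 → Set) (J : Set) → (J → M2) → Set
IsRightCosetReps H G J R =
  (∀ j → G (R j)) ×
  (∀ g → G g → ∃ λ j → H (g · adj (R j))) ×
  (∀ j j′ → H (R j · adj (R j′)) → j ≡ j′)

{-# OPTIONS --safe #-}
module Submission where

-- Conjugation by B_m maps Γ₀(mn) bijectively onto Γ₀(n, m) = {g ∈ Γ₀(n) : m ∣ b}, and
-- g·h⁻¹ ∈ Γ₀(mm′n) exactly when the conjugates satisfy the same relation for Γ₀(m′n).  This
-- makes the B_m R_j B_m⁻¹ lie in Γ₀(n) in pairwise distinct cosets.  They exhaust Γ₀(m′n)\Γ₀(n)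
-- because every coset meets Γ₀(n, m): left multiplication by (1 + tK, t; K, 1) with m′n ∣ K
-- changes b into b + t(Kb + d).  As m ⊥ m′, some K = m′n·k makes Kb + d prime to m (k is the
-- part of m prime to d), and then Bézout provides t with m ∣ b + t(Kb + d).

open import Defs
open import Data.Nat as ℕ using (ℕ; NonZero; _<_)
import Data.Nat.Properties as ℕ
import Data.Nat.Divisibility as ℕ
open import Data.Nat.Coprimality using (Coprime)
import Data.Nat.Coprimality as ℕ using (coprime?; gcd≡1⇒coprime; coprime-divisor; coprime-Bézout; sym)
import Data.Nat.GCD as ℕ
open import Data.Nat.GCD using (module Bézout)
open import Data.Nat.Induction using (<-wellFounded)
open import Data.Integer as ℤ using (ℤ; +_; -[1+_]; _+_; _*_; -_; _-_; 1ℤ; -1ℤ; ∣_∣; _/ℕ_)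
import Data.Integer.Properties as ℤ
import Data.Integer.DivMod as ℤ
import Data.Integer.GCD as ℤ
import Data.Integer.Coprimality as ℤ
import Data.Integer.Divisibility as Unsigned
open import Data.Integer.Divisibility.Signed
open import Data.Integer.Tactic.RingSolver using (solve-∀)
open import Data.Sum using (inj₁)
open import Data.Product using (∃; ∃₂; _×_; _,_; proj₁; map₂)
open import Function.Base using (it; _∘_)
open import Function.Bundles using (_⇔_; mk⇔; Equivalence)
open import Induction.WellFounded using (Acc; acc)
open import Relation.Nullary using (yes; no)
open import Relation.Binary.PropositionalEquality
open ≡-Reasoning

coprime-∣ˡ : ∀ {r m n} → Coprime m n → r ℕ.∣ m → Coprime r n
coprime-∣ˡ m⊥n r∣m (q∣r , q∣n) = m⊥n (ℕ.∣-trans q∣r r∣m , q∣n)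

-- Every prime factor of s divides D, phrased without primes.
PrimeFactorsDivide : ℕ → ℕ → Set
PrimeFactorsDivide s D = ∀ {r} → r ℕ.∣ s → Coprime r D → r ≡ 1

CoprimeSplit : ℕ → ℕ → Set
CoprimeSplit D t = ∃₂ λ t₁ s → t ≡ t₁ ℕ.* s × Coprime t₁ D × PrimeFactorsDivide s D

coprime-split : ∀ D t .{{_ : NonZero t}} → CoprimeSplit D t
coprime-split D t = split t (<-wellFounded t)
  where
  split : ∀ t → Acc _<_ t → .{{_ : NonZero t}} → CoprimeSplit D t
  split t (acc smaller) with ℕ.coprime? t D
  ... | yes t⊥D = t , 1 , sym (ℕ.*-identityʳ t) , t⊥D , λ r∣1 _ → ℕ.∣1⇒≡1 r∣1
  ... | no t⊥̸D with ℕ.divides h t≡h*g ← ℕ.gcd[m,n]∣m t D = peel h t≡h*g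
    where
    g = ℕ.gcd t D
    1<g : 1 < g
    1<g = ℕ.≤∧≢⇒< (ℕ.n≢0⇒n>0 (ℕ.gcd[m,n]≢0 t D (inj₁ (ℕ.≢-nonZero⁻¹ t))))
                  (λ 1≡g → t⊥̸D (ℕ.gcd≡1⇒coprime (sym 1≡g)))
    peel : ∀ h → t ≡ h ℕ.* g → CoprimeSplit D t
    peel h t≡h*g = extend (split h (smaller h<t) {{h≢0}})
      where
      h≢0 : NonZero h
      h≢0 = ℕ.m*n≢0⇒m≢0 h {{subst NonZero t≡h*g it}}
      h<t : h < t
      h<t = subst (h <_) (sym t≡h*g) (ℕ.m<m*n h g {{h≢0}} 1<g)
      extend : CoprimeSplit D h → CoprimeSplit D t
      extend (t₁ , s , h≡t₁*s , t₁⊥D , s|D) = t₁ , g ℕ.* s , t≡t₁*g*s , t₁⊥D , g*s|D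
        where
        t≡t₁*g*s : t ≡ t₁ ℕ.* (g ℕ.* s)
        t≡t₁*g*s = begin
          t                   ≡⟨ t≡h*g ⟩
          h ℕ.* g             ≡⟨ cong (ℕ._* g) h≡t₁*s ⟩
          t₁ ℕ.* s ℕ.* g      ≡⟨ ℕ.*-assoc t₁ s g ⟩
          t₁ ℕ.* (s ℕ.* g)    ≡⟨ cong (t₁ ℕ.*_) (ℕ.*-comm s g) ⟩
          t₁ ℕ.* (g ℕ.* s)    ∎
        g*s|D : PrimeFactorsDivide (g ℕ.* s) D
        g*s|D r∣g*s r⊥D = s|D (ℕ.coprime-divisor r⊥g r∣g*s) r⊥D
          where r⊥g = ℕ.sym (coprime-∣ˡ (ℕ.sym r⊥D) (ℕ.gcd[m,n]∣n t D))

-- The multiplier is the part of m prime to x.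
coprime-shift : ∀ m .{{_ : NonZero m}} x y → ℤ.Coprime (ℤ.gcd x y) (+ m) →
  ∃ λ k → ℤ.Coprime (x + + k * y) (+ m)
coprime-shift m x y gcd⊥m with t , s , m≡t*s , t⊥x , s|x ← coprime-split ∣ x ∣ m = t , z⊥m
  where
  z = x + + t * y
  ∣z∣t⇒∣x : ∀ {r} → r ℕ.∣ ∣ z ∣ → r ℕ.∣ t → r ℕ.∣ ∣ x ∣
  ∣z∣t⇒∣x {r} r∣z r∣t =
    ∣⇒∣ᵤ (∣m+n∣n⇒∣m {m = x} (∣ᵤ⇒∣ {+ r} {z} r∣z) (∣m⇒∣m*n y (∣ᵤ⇒∣ {+ r} {+ t} r∣t)))
  ∣z∣x⇒∣y : ∀ {r} → r ℕ.∣ ∣ z ∣ → r ℕ.∣ ∣ x ∣ → r ℕ.∣ ∣ y ∣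
  ∣z∣x⇒∣y {r} r∣z r∣x = ℕ.coprime-divisor (coprime-∣ˡ (ℕ.sym t⊥x) r∣x) (subst (r ℕ.∣_) (ℤ.abs-* (+ t) y)
    (∣⇒∣ᵤ (∣m+n∣m⇒∣n {n = + t * y} (∣ᵤ⇒∣ {+ r} {z} r∣z) (∣ᵤ⇒∣ {+ r} {x} r∣x))))
  z⊥m : ℤ.Coprime z (+ m)
  z⊥m {r} (r∣z , r∣m) = s|x r∣s r⊥x
    where
    r⊥t : Coprime r t
    r⊥t (q∣r , q∣t) = t⊥x (q∣t , ∣z∣t⇒∣x (ℕ.∣-trans q∣r r∣z) q∣t)
    r∣s : r ℕ.∣ s
    r∣s = ℕ.coprime-divisor r⊥t (subst (r ℕ.∣_) m≡t*s r∣m)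
    r⊥x : Coprime r ∣ x ∣
    r⊥x (q∣r , q∣x) =
      gcd⊥m (ℕ.gcd-greatest q∣x (∣z∣x⇒∣y (ℕ.∣-trans q∣r r∣z) q∣x) , ℕ.∣-trans q∣r r∣m)

sign-unit : ∀ x → ∃ λ σ → σ * x ≡ + ∣ x ∣
sign-unit (+ n)    = 1ℤ , ℤ.*-identityˡ (+ n)
sign-unit -[1+ n ] = -1ℤ , ℤ.-1*i≡-i -[1+ n ]

Bézout-ℕ⇒ℤ : ∀ P Q σ τ x y {X Y} → σ * x ≡ + X → τ * y ≡ + Y → 1 ℕ.+ Q ℕ.* Y ≡ P ℕ.* X →
             + P * σ * x + - (+ Q * τ) * y ≡ 1ℤ
Bézout-ℕ⇒ℤ P Q σ τ x y {X} {Y} σx τy eq = begin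
  + P * σ * x + - (+ Q * τ) * y    ≡⟨ regroup (+ P) σ x (+ Q) τ y ⟩
  + P * (σ * x) - + Q * (τ * y)    ≡⟨ cong₂ (λ u v → + P * u - + Q * v) σx τy ⟩
  + P * + X - + Q * + Y            ≡⟨ cong₂ _-_ (ℤ.pos-* P X) (ℤ.pos-* Q Y) ⟨
  + (P ℕ.* X) - + (Q ℕ.* Y)        ≡⟨ cong (λ u → + u - + (Q ℕ.* Y)) eq ⟨
  + (1 ℕ.+ Q ℕ.* Y) - + (Q ℕ.* Y)  ≡⟨ cong (_- + (Q ℕ.* Y)) (ℤ.pos-+ 1 (Q ℕ.* Y)) ⟩
  1ℤ + + (Q ℕ.* Y) - + (Q ℕ.* Y)   ≡⟨ cancel (+ (Q ℕ.* Y)) ⟩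
  1ℤ                               ∎
  where
  regroup : ∀ P σ x Q τ y → P * σ * x + - (Q * τ) * y ≡ P * (σ * x) - Q * (τ * y)
  regroup = solve-∀
  cancel : ∀ z → 1ℤ + z - z ≡ 1ℤ
  cancel = solve-∀

coprime⇒Bézout : ∀ x y → ℤ.Coprime x y → ∃₂ λ u v → u * x + v * y ≡ 1ℤ
coprime⇒Bézout x y x⊥y with sign-unit x | sign-unit y | ℕ.coprime-Bézout x⊥y
... | σ , σx | τ , τy | Bézout.+- p q eq = + p * σ , - (+ q * τ) , Bézout-ℕ⇒ℤ p q σ τ x y σx τy eq
... | σ , σx | τ , τy | Bézout.-+ p q eq = - (+ p * σ) , + q * τ ,
  trans (ℤ.+-comm (- (+ p * σ) * x) (+ q * τ * y)) (Bézout-ℕ⇒ℤ q p τ σ y x τy σx eq)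

i*n/ℕn≡i : ∀ i n .{{_ : NonZero n}} → (i * + n) /ℕ n ≡ i
i*n/ℕn≡i i n@(ℕ.suc _) = ℤ.≤-antisym q≤i i≤q
  where
  q = (i * + n) /ℕ n
  q≤i : q ℤ.≤ i
  q≤i = ℤ.*-cancelʳ-≤-pos q i (+ n) (ℤ.[n/ℕd]*d≤n (i * + n) n)
  i≤q : i ℤ.≤ q
  i≤q = subst (i ℤ.≤_) (ℤ.pred-suc q)
          (ℤ.i<j⇒i≤pred[j] (ℤ.*-cancelʳ-<-nonNeg {j = ℤ.suc q} (+ n) (ℤ.n<s[n/ℕd]*d (i * + n) n)))

≡-mat : ∀ {a b c d a′ b′ c′ d′} → a ≡ a′ → b ≡ b′ → c ≡ c′ → d ≡ d′ → mat a b c d ≡ mat a′ b′ c′ d′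
≡-mat refl refl refl refl = refl

·-assoc : ∀ g h k → (g · h) · k ≡ g · (h · k)
·-assoc (mat a b c d) (mat a′ b′ c′ d′) (mat a″ b″ c″ d″) =
  ≡-mat (entry a b a′ b′ c′ d′ a″ c″) (entry a b a′ b′ c′ d′ b″ d″)
        (entry c d a′ b′ c′ d′ a″ c″) (entry c d a′ b′ c′ d′ b″ d″)
  where
  entry : ∀ x y p q r s u v →
    (x * p + y * r) * u + (x * q + y * s) * v ≡ x * (p * u + q * v) + y * (r * u + s * v)
  entry = solve-∀

det-· : ∀ g h → det (g · h) ≡ det g * det h
det-· (mat a b c d) (mat a′ b′ c′ d′) = multiplicative a b c d a′ b′ c′ d′
  where
  multiplicative : ∀ a b c d a′ b′ c′ d′ →
    (a * a′ + b * c′) * (c * b′ + d * d′) - (a * b′ + b * d′) * (c * a′ + d * c′)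
      ≡ (a * d - b * c) * (a′ * d′ - b′ * c′)
  multiplicative = solve-∀

c[adj·] : ∀ γ g → c (adj γ · (γ · g)) ≡ det γ * c g
c[adj·] (mat a b c d) (mat a′ b′ c′ d′) = cramer a b c d a′ c′
  where
  cramer : ∀ a b c d a′ c′ → - c * (a * a′ + b * c′) + a * (c * a′ + d * c′) ≡ (a * d - b * c) * c′
  cramer = solve-∀

det≡1⇒coprime[c,d] : ∀ g → det g ≡ 1ℤ → ℤ.Coprime (c g) (d g)
det≡1⇒coprime[c,d] (mat a b c d) det≡1 {r} (r∣c , r∣d) =
  ℕ.∣1⇒≡1 (∣⇒∣ᵤ (subst (+ r ∣_) det≡1
    (∣m∣n⇒∣m-n (∣n⇒∣m*n a (∣ᵤ⇒∣ {+ r} {d} r∣d)) (∣n⇒∣m*n b (∣ᵤ⇒∣ {+ r} {c} r∣c)))))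

det≡1⇒coprime[b,d] : ∀ g → det g ≡ 1ℤ → ℤ.Coprime (b g) (d g)
det≡1⇒coprime[b,d] (mat a b c d) det≡1 {r} (r∣b , r∣d) =
  ℕ.∣1⇒≡1 (∣⇒∣ᵤ (subst (+ r ∣_) det≡1
    (∣m∣n⇒∣m-n (∣n⇒∣m*n a (∣ᵤ⇒∣ {+ r} {d} r∣d)) (∣m⇒∣m*n c (∣ᵤ⇒∣ {+ r} {b} r∣b)))))

mkΓ₀ : ∀ {N} g → det g ≡ 1ℤ → + N ∣ c g → Γ₀ N g
mkΓ₀ _ det≡1 N∣c = det≡1 , ∣⇒∣ᵤ N∣c

Γ₀⇒∣c : ∀ {N} g → Γ₀ N g → + N ∣ c g
Γ₀⇒∣c {N} g (_ , N∣c) = ∣ᵤ⇒∣ {+ N} {c g} N∣c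

Γ₀-mono : ∀ {N N′} g → N ℕ.∣ N′ → Γ₀ N′ g → Γ₀ N g
Γ₀-mono _ N∣N′ (det≡1 , N′∣c) = det≡1 , ℕ.∣-trans N∣N′ N′∣c

Γ₀[m*N]⇒m∣c : ∀ m N g → Γ₀ (m ℕ.* N) g → + m ∣ c g
Γ₀[m*N]⇒m∣c m N g g∈ = ∣-trans (∣ᵤ⇒∣ {+ m} {+ (m ℕ.* N)} (ℕ.m∣m*n N)) (Γ₀⇒∣c g g∈)

Γ₀-· : ∀ {N} g h → Γ₀ N g → Γ₀ N h → Γ₀ N (g · h)
Γ₀-· g h g∈ h∈ =
  mkΓ₀ (g · h) (trans (det-· g h) (cong₂ _*_ (proj₁ g∈) (proj₁ h∈)))
       (∣m∣n⇒∣m+n (∣m⇒∣m*n (a h) (Γ₀⇒∣c g g∈)) (∣n⇒∣m*n (d g) (Γ₀⇒∣c h h∈)))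

Γ₀-cancelˡ : ∀ {N} γ g → Γ₀ N γ → Γ₀ N (γ · g) → Γ₀ N g
Γ₀-cancelˡ {N} γ g γ∈ γg∈ = mkΓ₀ g det≡1 (subst (+ N ∣_) c≡ N∣)
  where
  det≡1 : det g ≡ 1ℤ
  det≡1 = begin
    det g            ≡⟨ ℤ.*-identityˡ (det g) ⟨
    1ℤ * det g       ≡⟨ cong (_* det g) (proj₁ γ∈) ⟨
    det γ * det g    ≡⟨ det-· γ g ⟨
    det (γ · g)      ≡⟨ proj₁ γg∈ ⟩
    1ℤ               ∎
  N∣ : + N ∣ c (adj γ · (γ · g))
  N∣ = ∣m∣n⇒∣m+n (∣m⇒∣m*n (a (γ · g)) (∣m⇒∣-m (Γ₀⇒∣c γ γ∈))) (∣n⇒∣m*n (a γ) (Γ₀⇒∣c (γ · g) γg∈))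
  c≡ : c (adj γ · (γ · g)) ≡ c g
  c≡ = trans (c[adj·] γ g) (trans (cong (_* c g) (proj₁ γ∈)) (ℤ.*-identityˡ (c g)))

conjB-of-c≡ : ∀ m .{{_ : NonZero m}} g e → c g ≡ e * + m → conjB m g ≡ mat (a g) (+ m * b g) e (d g)
conjB-of-c≡ m g e c≡e*m =
  cong (λ x → mat (a g) (+ m * b g) x (d g)) (trans (cong (λ x → x /ℕ m) c≡e*m) (i*n/ℕn≡i e m))

Γ₀-rescale : ∀ m N .{{_ : NonZero m}} a b e d →
  Γ₀ (m ℕ.* N) (mat a b (e * + m) d) ⇔ Γ₀ N (mat a (+ m * b) e d)
Γ₀-rescale m N a b e d = mk⇔
  (λ (det≡1 , mN∣c) → trans det≡ det≡1 ,
     Unsigned.*-cancelʳ-∣ (+ m) {+ N} {e} (subst (Unsigned._∣ e * + m) mN≡ mN∣c))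
  (λ (det≡1 , N∣e) → trans (sym det≡) det≡1 ,
     subst (Unsigned._∣ e * + m) (sym mN≡) (Unsigned.*-monoˡ-∣ (+ m) {+ N} {e} N∣e))
  where
  regroup : ∀ a b d e m → a * d - m * b * e ≡ a * d - b * (e * m)
  regroup = solve-∀
  det≡ : a * d - + m * b * e ≡ a * d - b * (e * + m)
  det≡ = regroup a b d e (+ m)
  mN≡ : + (m ℕ.* N) ≡ + N * + m
  mN≡ = trans (cong +_ (ℕ.*-comm m N)) (ℤ.pos-* N m)

Γ₀-conjB : ∀ m N .{{_ : NonZero m}} g → + m ∣ c g → Γ₀ (m ℕ.* N) g ⇔ Γ₀ N (conjB m g)
Γ₀-conjB m N g@(mat a b _ d) (divides e refl) =
  subst (λ h → Γ₀ (m ℕ.* N) g ⇔ Γ₀ N h) (sym (conjB-of-c≡ m g e refl)) (Γ₀-rescale m N a b e d)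

c[·adj] : ∀ m g h e e′ → c g ≡ e * + m → c h ≡ e′ * + m →
  c (g · adj h) ≡ (e * d h + d g * - e′) * + m
c[·adj] m g h e e′ c≡e*m c≡e′*m = begin
  c g * d h + d g * - c h               ≡⟨ cong₂ (λ x y → x * d h + d g * - y) c≡e*m c≡e′*m ⟩
  e * + m * d h + d g * - (e′ * + m)    ≡⟨ factor e (d h) (d g) e′ (+ m) ⟩
  (e * d h + d g * - e′) * + m          ∎
  where
  factor : ∀ e d′ d e′ m → e * m * d′ + d * - (e′ * m) ≡ (e * d′ + d * - e′) * m
  factor = solve-∀

m∣c[·adj] : ∀ m g h → + m ∣ c g → + m ∣ c h → + m ∣ c (g · adj h)
m∣c[·adj] m g h (divides e c≡e*m) (divides e′ c≡e′*m) =
  divides (e * d h + d g * - e′) (c[·adj] m g h e e′ c≡e*m c≡e′*m)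

conjB-·-adj : ∀ m .{{_ : NonZero m}} g h → + m ∣ c g → + m ∣ c h →
  conjB m (g · adj h) ≡ conjB m g · adj (conjB m h)
conjB-·-adj m g@(mat a b _ d) h@(mat a′ b′ _ d′) (divides e refl) (divides e′ refl) = begin
  conjB m (g · adj h)
    ≡⟨ conjB-of-c≡ m (g · adj h) (e * d′ + d * - e′) (c[·adj] m g h e e′ refl refl) ⟩
  mat (a * d′ + b * - (e′ * + m)) (+ m * (a * - b′ + b * a′)) (e * d′ + d * - e′) (e * + m * - b′ + d * a′)
    ≡⟨ ≡-mat (entryᵃ a b d′ e′ (+ m)) (entryᵇ a b a′ b′ (+ m)) refl (entryᵈ e b′ d a′ (+ m)) ⟩
  mat a (+ m * b) e d · adj (mat a′ (+ m * b′) e′ d′)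
    ≡⟨ cong₂ (λ x y → x · adj y) (conjB-of-c≡ m g e refl) (conjB-of-c≡ m h e′ refl) ⟨
  conjB m g · adj (conjB m h) ∎
  where
  entryᵃ : ∀ a b d′ e′ m → a * d′ + b * - (e′ * m) ≡ a * d′ + m * b * - e′
  entryᵃ = solve-∀
  entryᵇ : ∀ a b a′ b′ m → m * (a * - b′ + b * a′) ≡ a * - (m * b′) + m * b * a′
  entryᵇ = solve-∀
  entryᵈ : ∀ e b′ d a′ m → e * m * - b′ + d * a′ ≡ e * - (m * b′) + d * a′
  entryᵈ = solve-∀

Γ₀-conjB-coset : ∀ m N .{{_ : NonZero m}} g h → + m ∣ c g → + m ∣ c h →
  Γ₀ (m ℕ.* N) (g · adj h) ⇔ Γ₀ N (conjB m g · adj (conjB m h))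
Γ₀-conjB-coset m N g h m∣cg m∣ch =
  subst (λ x → Γ₀ (m ℕ.* N) (g · adj h) ⇔ Γ₀ N x) (conjB-·-adj m g h m∣cg m∣ch)
        (Γ₀-conjB m N (g · adj h) (m∣c[·adj] m g h m∣cg m∣ch))

Γ₀[_,_] : ℕ → ℕ → M2 → Set
Γ₀[ N , m ] g = Γ₀ N g × + m ∣ b g

conjB-onto-Γ₀[,] : ∀ m N .{{_ : NonZero m}} h → Γ₀[ N , m ] h →
  ∃ λ g → Γ₀ (m ℕ.* N) g × conjB m g ≡ h
conjB-onto-Γ₀[,] m N h@(mat a b c d) (h∈ , divides β b≡β*m) =
  g , Equivalence.from (Γ₀-conjB m N g (divides c refl)) (subst (Γ₀ N) (sym conjB[g]≡h) h∈) , conjB[g]≡h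
  where
  g = mat a β (c * + m) d
  conjB[g]≡h : conjB m g ≡ h
  conjB[g]≡h = trans (conjB-of-c≡ m g c refl)
                     (cong (λ x → mat a x c d) (trans (ℤ.*-comm (+ m) β) (sym b≡β*m)))

Γ₀-d-shift-coprime : ∀ m m′ n .{{_ : NonZero m}} → Coprime m m′ → ∀ g → Γ₀ n g →
  ∃ λ k → ℤ.Coprime (d g + + k * (+ (m′ ℕ.* n) * b g)) (+ m)
Γ₀-d-shift-coprime m m′ n m⊥m′ g (det≡1 , n∣c) = coprime-shift m (d g) (+ (m′ ℕ.* n) * b g) gcd⊥m
  where
  gcd⊥m : ℤ.Coprime (ℤ.gcd (d g) (+ (m′ ℕ.* n) * b g)) (+ m)
  gcd⊥m {r} (r∣gcd , r∣m) = det≡1⇒coprime[b,d] g det≡1 (r∣b , r∣d)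
    where
    r∣d : r ℕ.∣ ∣ d g ∣
    r∣d = ℕ.∣-trans r∣gcd (ℕ.gcd[m,n]∣m ∣ d g ∣ ∣ + (m′ ℕ.* n) * b g ∣)
    r∣m′nb : r ℕ.∣ m′ ℕ.* (n ℕ.* ∣ b g ∣)
    r∣m′nb = subst (r ℕ.∣_) (trans (ℤ.abs-* (+ (m′ ℕ.* n)) (b g)) (ℕ.*-assoc m′ n ∣ b g ∣))
                   (ℕ.∣-trans r∣gcd (ℕ.gcd[m,n]∣n ∣ d g ∣ ∣ + (m′ ℕ.* n) * b g ∣))
    r⊥n : Coprime r n
    r⊥n (q∣r , q∣n) = det≡1⇒coprime[c,d] g det≡1 (ℕ.∣-trans q∣n n∣c , ℕ.∣-trans q∣r r∣d)
    r∣b : r ℕ.∣ ∣ b g ∣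
    r∣b = ℕ.coprime-divisor r⊥n (ℕ.coprime-divisor (coprime-∣ˡ m⊥m′ r∣m) r∣m′nb)

Γ₀-translate-into-Γ₀[,] : ∀ m m′ n .{{_ : NonZero m}} → Coprime m m′ → ∀ g → Γ₀ n g →
  ∃ λ γ → Γ₀ (m′ ℕ.* n) γ × Γ₀[ n , m ] (γ · g)
Γ₀-translate-into-Γ₀[,] m m′ n m⊥m′ g g∈
  with k , z⊥m ← Γ₀-d-shift-coprime m m′ n m⊥m′ g g∈
  with u , v , u*z+v*m≡1 ← coprime⇒Bézout (d g + + k * (+ (m′ ℕ.* n) * b g)) (+ m) z⊥m =
  γ , γ∈ , Γ₀-· γ g (Γ₀-mono γ (ℕ.n∣m*n m′) γ∈) g∈ , divides (b g * v) b[γg]≡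
  where
  M = + (m′ ℕ.* n)
  z = d g + + k * (M * b g)
  K = + k * M
  t = - (b g * u)
  γ = mat (1ℤ + t * K) t K 1ℤ
  unimodular : ∀ t K → (1ℤ + t * K) * 1ℤ - t * K ≡ 1ℤ
  unimodular = solve-∀
  γ∈ : Γ₀ (m′ ℕ.* n) γ
  γ∈ = mkΓ₀ γ (unimodular t K) (divides (+ k) refl)
  regroup : ∀ b d u v k M m → (1ℤ + - (b * u) * (k * M)) * b + - (b * u) * d
                              ≡ b * (v * m) + b * (1ℤ - (u * (d + k * (M * b)) + v * m))
  regroup = solve-∀
  tidy : ∀ b v m → b * (v * m) + b * (1ℤ - 1ℤ) ≡ b * v * m
  tidy = solve-∀
  b[γg]≡ : b (γ · g) ≡ b g * v * + m
  b[γg]≡ = begin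
    (1ℤ + t * K) * b g + t * d g
      ≡⟨ regroup (b g) (d g) u v (+ k) M (+ m) ⟩
    b g * (v * + m) + b g * (1ℤ - (u * z + v * + m))
      ≡⟨ cong (λ x → b g * (v * + m) + b g * (1ℤ - x)) u*z+v*m≡1 ⟩
    b g * (v * + m) + b g * (1ℤ - 1ℤ)
      ≡⟨ tidy (b g) v (+ m) ⟩
    b g * v * + m ∎

Γ₀-coset-meets-conjB : ∀ m m′ n .{{_ : NonZero m}} → Coprime m m′ → ∀ g → Γ₀ n g →
  ∃ λ γ → Γ₀ (m′ ℕ.* n) γ × ∃ λ g′ → Γ₀ (m ℕ.* n) g′ × conjB m g′ ≡ γ · g
Γ₀-coset-meets-conjB m m′ n m⊥m′ g g∈ = pull-back (Γ₀-translate-into-Γ₀[,] m m′ n m⊥m′ g g∈)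
  where
  pull-back : (∃ λ γ → Γ₀ (m′ ℕ.* n) γ × Γ₀[ n , m ] (γ · g)) →
              ∃ λ γ → Γ₀ (m′ ℕ.* n) γ × ∃ λ g′ → Γ₀ (m ℕ.* n) g′ × conjB m g′ ≡ γ · g
  pull-back (γ , γ∈ , γg∈) = γ , γ∈ , conjB-onto-Γ₀[,] m n (γ · g) γg∈

lemma3p6 : (n m m′ : ℕ) → .{{_ : NonZero n}} → .{{_ : NonZero m}} → .{{_ : NonZero m′}} →
    Coprime m m′ →
    (J : Set) (R : J → M2) →
    IsRightCosetReps (Γ₀ (m ℕ.* m′ ℕ.* n)) (Γ₀ (m ℕ.* n)) J R →
    IsRightCosetReps (Γ₀ (m′ ℕ.* n)) (Γ₀ n) J (λ j → conjB m (R j))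
lemma3p6 n m m′ m⊥m′ J R (R∈ , R-covers , R-distinct) = conjR∈ , conjR-covers , conjR-distinct
  where
  m∣c[R] : ∀ j → + m ∣ c (R j)
  m∣c[R] j = Γ₀[m*N]⇒m∣c m n (R j) (R∈ j)
  coset : ∀ g j → Γ₀ (m ℕ.* n) g →
    Γ₀ (m ℕ.* m′ ℕ.* n) (g · adj (R j)) ⇔ Γ₀ (m′ ℕ.* n) (conjB m g · adj (conjB m (R j)))
  coset g j g∈ =
    subst (λ N → Γ₀ N (g · adj (R j)) ⇔ Γ₀ (m′ ℕ.* n) (conjB m g · adj (conjB m (R j))))
          (sym (ℕ.*-assoc m m′ n))
          (Γ₀-conjB-coset m (m′ ℕ.* n) g (R j) (Γ₀[m*N]⇒m∣c m n g g∈) (m∣c[R] j))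
  conjR∈ : ∀ j → Γ₀ n (conjB m (R j))
  conjR∈ j = Equivalence.to (Γ₀-conjB m n (R j) (m∣c[R] j)) (R∈ j)
  conjR-covers : ∀ g → Γ₀ n g → ∃ λ j → Γ₀ (m′ ℕ.* n) (g · adj (conjB m (R j)))
  conjR-covers g g∈ = via (Γ₀-coset-meets-conjB m m′ n m⊥m′ g g∈)
    where
    via : (∃ λ γ → Γ₀ (m′ ℕ.* n) γ × ∃ λ g′ → Γ₀ (m ℕ.* n) g′ × conjB m g′ ≡ γ · g) →
          ∃ λ j → Γ₀ (m′ ℕ.* n) (g · adj (conjB m (R j)))
    via (γ , γ∈ , g′ , g′∈ , conjB[g′]≡γg) = map₂ (λ {j} g′∼Rj → Γ₀-cancelˡ γ _ γ∈
      (subst (Γ₀ (m′ ℕ.* n)) (trans (cong (_· adj (conjB m (R j))) conjB[g′]≡γg) (·-assoc γ g _))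
             (Equivalence.to (coset g′ j g′∈) g′∼Rj))) (R-covers g′ g′∈)
  conjR-distinct : ∀ j j′ → Γ₀ (m′ ℕ.* n) (conjB m (R j) · adj (conjB m (R j′))) → j ≡ j′
  conjR-distinct j j′ = R-distinct j j′ ∘ Equivalence.from (coset (R j) j′ (R∈ j))
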